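{- Let $p$ be a prime. For any integers $B,L,M$ with $0\le B<B+L<p$ and $0\le M<p$, the number of integer pairs $(y,z)$ with $$(B+y)z\equiv1\pmod p,\qquad 1\le y\le L,\quad 1\le z\le M$$ is at most $p^{ -1/2+o(1)}L^{1/2}M+p^{o(1)}$, where $p^{o(1)}$ denotes a factor $p^{\epsilon(p)}$ with $\epsilon(p)\to0$ as $p\to\infty$, uniformly in $B,L,M$. -}

module Defs where

open import Data.Nat using (ℕ; suc; _+_; _*_; _≡ᵇ_; NonZero)
open import Data.Nat.DivMod using (_%_)
open import Data.List using (List; length; filterᵇ; applyUpTo; cartesianProduct)
open import Data.Product using (_×_; _,_)

range1 : ℕ → List ℕ
range1 n = applyUpTo suc n

solCount : (p : ℕ) → .{{NonZero p}} → (B L M : ℕ) → ℕ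
solCount p B L M =
  length (filterᵇ (λ { (y , z) → ((B + y) * z) % p ≡ᵇ 1 % p })
                  (cartesianProduct (range1 L) (range1 M)))

-- Take T maximal with T ^ 2 L ≤ p.  By Dirichlet's pigeonhole argument
-- some 1 ≤ r ≤ T has r B ≡ ± s (mod p) with s T < p.  Multiplying a solution by
-- r gives z e ≡ ± r (mod p) for some e with e T ≤ 2 p, so z divides r + j p or
-- (p - r) + j p for some j ≤ J = ⌊2 M / T⌋.  As z determines y, the number N
-- of solutions is at most the number of these divisors: N ≤ 2 (J + 1) D, where
-- D bounds the divisor count τ on [1, 3 p ^ 2].  The divisor bound
-- τ n ^ t ≤ C_t n with t = 4 K gives (256 D ^ 2) ^ K ≤ p ^ 2 once p ≥ p₀; then
-- J = 0 yields N ^ K ≤ p and J ≥ 1 yields N ^ (2 K) p ^ K ≤ p ^ 2 L ^ K M ^ (2 K).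
module Submission where

open import Defs
open import Data.Nat using (ℕ; suc; _+_; _*_; _^_; _≤_; _<_; NonZero)
open import Data.Nat.Primality using (Prime)
open import Data.Product using (∃)
open import Data.Sum using (_⊎_)

open import Data.Nat
  using (zero; _∸_; z≤n; s≤s; NonTrivial; _≤?_; ≢-nonZero; ≢-nonZero⁻¹; >-nonZero; >-nonZero⁻¹;
         nonTrivial⇒n>1; n>1⇒nonTrivial)
open import Data.Nat.Induction using (<-rec)
open import Data.Nat.Properties
open import Data.Nat.Divisibility
  using (_∣_; _∤_; _∣?_; divides; ∣-refl; ∣-trans; ∣⇒≤; 0∣⇒≡0; m∣m*n; n∣m*n; *-cancelˡ-∣; m%n≡0⇒n∣m)
open import Data.Nat.Coprimality using (Coprime; coprime-divisor)
open import Data.Nat.Primality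
  using (prime; euclidsLemma; prime⇒irreducible; prime⇒nonZero; prime⇒nonTrivial;
         _Rough_; 2-rough; rough∧∣⇒prime; rough∧∣⇒rough; ∤⇒rough-suc; rough⇒≤)
open import Data.Nat.DivMod
  using (_/_; _%_; m≡m%n+[m/n]*n; m%n<n; [m+kn]%n≡m%n; m<n⇒m%n≡m; m%n%n≡m%n;
         m/n*n≤m; /-monoˡ-≤; m<n*o⇒m/o<n; m/n≡1+[m∸n]/n; m*n/n≡m; m/n≤m)
open import Relation.Binary.Bundles using (Setoid)
import Relation.Binary.Reasoning.Setoid as SetoidReasoning
open import Data.Fin as Fin using (Fin; toℕ; fromℕ<)
open import Data.Fin.Properties using (pigeonhole; toℕ-fromℕ<; toℕ<n)
open import Data.List using (List; []; _∷_; _++_; length; map; filter; filterᵇ; cartesianProduct; concatMap; upTo)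
open import Data.Bool using (Bool) renaming (T to IsTrue)
open import Data.List.Properties using (length-++; length-map; length-upTo; length-removeAt′)
open import Data.List.Membership.Propositional using (_∈_; _─_; lose)
open import Data.List.Membership.Propositional.Properties
  using (∈-filter⁺; ∈-filter⁻; ∈-applyUpTo⁺; ∈-applyUpTo⁻; ∈-map⁺; ∈-map⁻; ∈-concatMap⁺; ∈-upTo⁺; ∈-upTo⁻;
         ∈-++⁺ˡ; ∈-++⁺ʳ; ∈-cartesianProduct⁻)
open import Data.List.Relation.Unary.All as All using (All; []; _∷_)
import Data.List.Relation.Unary.All.Properties as AllP
open import Data.List.Relation.Unary.Any using (here; there)
open import Data.List.Relation.Unary.Unique.Propositional using (Unique; []; _∷_)
import Data.List.Relation.Unary.Unique.Propositional.Properties as Unique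
open import Data.Product using (∃₂; _×_; _,_; proj₁; proj₂; map₂)
open import Data.Sum using (inj₁; inj₂)
open import Data.Empty using (⊥-elim)
open import Relation.Nullary using (Dec; yes; no; contradiction)
open import Relation.Binary.PropositionalEquality
  using (_≡_; _≢_; refl; sym; trans; cong; cong₂; subst; module ≡-Reasoning)
open import Function using (_∘_)
open import Data.Nat.Tactic.RingSolver using (solve-∀)

private
  variable
    A A′ : Set

∈-─ : ∀ {x y : A} (xs : List A) (x∈ : x ∈ xs) → y ∈ xs → y ≢ x → y ∈ xs ─ x∈
∈-─ (_ ∷ _)  (here refl) (here refl) y≢x = ⊥-elim (y≢x refl)
∈-─ (_ ∷ _)  (here refl) (there y∈)  _   = y∈
∈-─ (_ ∷ _)  (there x∈)  (here refl) _   = here refl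
∈-─ (_ ∷ xs) (there x∈)  (there y∈)  y≢x = there (∈-─ xs x∈ y∈ y≢x)

unique-⊆-length : (xs ys : List A) → Unique xs → (∀ {x} → x ∈ xs → x ∈ ys) →
                  length xs ≤ length ys
unique-⊆-length []       ys _            _  = z≤n
unique-⊆-length (x ∷ xs) ys (x∉xs ∷ uxs) xs⊆ys = begin
  suc (length xs)        ≤⟨ s≤s (unique-⊆-length xs (ys ─ x∈ys) uxs xs⊆ys─x) ⟩
  suc (length (ys ─ x∈ys)) ≡⟨ sym (length-removeAt′ ys _) ⟩
  length ys              ∎
  where
  open ≤-Reasoning
  x∈ys = xs⊆ys (here refl)
  xs⊆ys─x : ∀ {y} → y ∈ xs → y ∈ ys ─ x∈ys
  xs⊆ys─x y∈xs = ∈-─ ys x∈ys (xs⊆ys (there y∈xs)) (λ y≡x → All.lookup x∉xs y∈xs (sym y≡x))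

map-unique : (f : A → A′) (P : A → Set) (xs : List A) → All P xs → Unique xs →
             (∀ {a b} → P a → P b → a ≢ b → f a ≢ f b) → Unique (map f xs)
map-unique f P []       _          _            _   = []
map-unique f P (x ∷ xs) (px ∷ pxs) (x∉xs ∷ uxs) inj =
  AllP.map⁺ (All.zipWith (λ (py , x≢y) → inj px py x≢y) (pxs , x∉xs)) ∷ map-unique f P xs pxs uxs inj

length-concatMap-≤ : (f : A → List A′) (xs : List A) (D : ℕ) →
                     (∀ {x} → x ∈ xs → length (f x) ≤ D) →
                     length (concatMap f xs) ≤ length xs * D
length-concatMap-≤ f []       D _ = z≤n
length-concatMap-≤ f (x ∷ xs) D bound = begin
  length (f x ++ concatMap f xs)        ≡⟨ length-++ (f x) ⟩
  length (f x) + length (concatMap f xs) ≤⟨ +-mono-≤ (bound (here refl)) (length-concatMap-≤ f xs D (bound ∘ there)) ⟩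
  D + length xs * D                     ∎
  where open ≤-Reasoning

∈-range1⁺ : ∀ {z n} → 1 ≤ z → z ≤ n → z ∈ range1 n
∈-range1⁺ {suc _} _ z≤bound = ∈-applyUpTo⁺ suc z≤bound

∈-range1⁻ : ∀ {z n} → z ∈ range1 n → 1 ≤ z × z ≤ n
∈-range1⁻ z∈ with ∈-applyUpTo⁻ suc z∈
... | _ , i<n , refl = s≤s z≤n , i<n

range1-unique : ∀ n → Unique (range1 n)
range1-unique n = Unique.applyUpTo⁺₁ suc n (λ i<j _ i≡j → <⇒≢ i<j (suc-injective i≡j))

divisors : ℕ → List ℕ
divisors n = filter (_∣? n) (range1 n)

τ : ℕ → ℕ
τ n = length (divisors n)

divisors-unique : ∀ n → Unique (divisors n)
divisors-unique n = Unique.filter⁺ (_∣? n) (range1-unique n)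

∈-divisors⁺ : ∀ {d n} → .{{NonZero n}} → d ∣ n → d ∈ divisors n
∈-divisors⁺ {zero}  {n} 0∣n = contradiction (0∣⇒≡0 0∣n) (≢-nonZero⁻¹ n)
∈-divisors⁺ {suc d}     d∣n = ∈-filter⁺ (_∣? _) (∈-range1⁺ (s≤s z≤n) (∣⇒≤ d∣n)) d∣n

∈-divisors⁻ : ∀ {d n} → d ∈ divisors n → 1 ≤ d × d ∣ n
∈-divisors⁻ {n = n} d∈ with ∈-filter⁻ (_∣? n) {xs = range1 n} d∈
... | d∈range , d∣n = proj₁ (∈-range1⁻ d∈range) , d∣n

factorOut : ∀ q → 2 ≤ q → ∀ n → .{{NonZero n}} → ∃₂ λ i m → n ≡ q ^ i * m × q ∤ m
factorOut q 2≤q = <-rec (λ n → .{{NonZero n}} → ∃₂ λ i m → n ≡ q ^ i * m × q ∤ m) split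
  where
  split : ∀ n → (∀ {m} → m < n → .{{NonZero m}} → ∃₂ λ i e → m ≡ q ^ i * e × q ∤ e) →
          .{{NonZero n}} → ∃₂ λ i m → n ≡ q ^ i * m × q ∤ m
  split n rec with q ∣? n
  ... | no q∤n = 0 , n , sym (*-identityˡ n) , q∤n
  ... | yes (divides m refl) =
    let instance m≢0 = m*n≢0⇒m≢0 m
        i , e , m≡ , q∤e = rec (m<m*n m q 2≤q)
    in suc i , e , (begin
         m * q           ≡⟨ *-comm m q ⟩
         q * m           ≡⟨ cong (q *_) m≡ ⟩
         q * (q ^ i * e) ≡⟨ *-assoc q (q ^ i) e ⟨
         q ^ suc i * e   ∎) , q∤e
    where open ≡-Reasoning

∤prime⇒coprime : ∀ {q e} → Prime q → q ∤ e → Coprime e q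
∤prime⇒coprime pq q∤e (d∣e , d∣q) with prime⇒irreducible pq d∣q
... | inj₁ d≡1 = d≡1
... | inj₂ refl = contradiction d∣e q∤e

coprime-strip : ∀ {q e} a m → Coprime e q → e ∣ q ^ a * m → e ∣ m
coprime-strip zero    m _     e∣ = subst (_ ∣_) (*-identityˡ m) e∣
coprime-strip {q} {e} (suc a) m e⊥q e∣ =
  coprime-strip a m e⊥q (coprime-divisor e⊥q (subst (e ∣_) (*-assoc q (q ^ a) m) e∣))

exponent-bound : ∀ {q} i a m → Prime q → q ∤ m → q ^ i ∣ q ^ a * m → i ≤ a
exponent-bound zero    a       m _  _   _  = z≤n
exponent-bound {q} (suc i) zero    m _  q∤m q∣ =
  contradiction (∣-trans (m∣m*n (q ^ i)) (subst (_ ∣_) (*-identityˡ m) q∣)) q∤m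
exponent-bound {q} (suc i) (suc a) m pq q∤m q∣ = s≤s (exponent-bound i a m pq q∤m
  (*-cancelˡ-∣ q {{prime⇒nonZero pq}} (subst (q * q ^ i ∣_) (*-assoc q (q ^ a) m) q∣)))

prime⇒2≤ : ∀ {q} → Prime q → 2 ≤ q
prime⇒2≤ {q} pq = nonTrivial⇒n>1 q {{prime⇒nonTrivial pq}}

-- For a prime q ∤ m, every divisor of q ^ a * m is q ^ i * e with i ≤ a and
-- e ∣ m, so the divisors of q ^ a * m lie in a + 1 blocks of τ m numbers.
τ-prime-power : ∀ {q} a m → Prime q → q ∤ m → .{{NonZero m}} → τ (q ^ a * m) ≤ suc a * τ m
τ-prime-power {q} a m pq q∤m = begin
  τ n                          ≤⟨ unique-⊆-length (divisors n) candidates (divisors-unique n) divisor⇒candidate ⟩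
  length candidates            ≤⟨ length-concatMap-≤ block (upTo (suc a)) (τ m) (λ _ → ≤-reflexive (length-map _ (divisors m))) ⟩
  length (upTo (suc a)) * τ m  ≡⟨ cong (_* τ m) (length-upTo (suc a)) ⟩
  suc a * τ m                  ∎
  where
  open ≤-Reasoning
  instance
    q≢0 = prime⇒nonZero pq
    qᵃ≢0 = m^n≢0 q a
  n = q ^ a * m
  instance n≢0 = m*n≢0 (q ^ a) m
  block : ℕ → List ℕ
  block i = map (q ^ i *_) (divisors m)
  candidates = concatMap block (upTo (suc a))
  divisor⇒candidate : ∀ {d} → d ∈ divisors n → d ∈ candidates
  divisor⇒candidate {d} d∈ with ∈-divisors⁻ {n = n} d∈
  ... | 1≤d , d∣n with factorOut q (prime⇒2≤ pq) d {{>-nonZero 1≤d}}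
  ... | i , e , refl , q∤e =
    ∈-concatMap⁺ block (lose (∈-upTo⁺ (s≤s i≤a)) (∈-map⁺ (q ^ i *_) (∈-divisors⁺ e∣m)))
    where
    e∣m = coprime-strip a m (∤prime⇒coprime pq q∤e) (∣-trans (n∣m*n (q ^ i)) d∣n)
    i≤a = exponent-bound i a m pq q∤m (∣-trans (m∣m*n e) d∣n)

*-^ : ∀ x y n → (x * y) ^ n ≡ x ^ n * y ^ n
*-^ x y zero    = refl
*-^ x y (suc n) = trans (cong ((x * y) *_) (*-^ x y n)) (interchange x y (x ^ n) (y ^ n))
  where
  interchange : ∀ x y u v → (x * y) * (u * v) ≡ (x * u) * (y * v)
  interchange = solve-∀

1+n≤2^n : ∀ a → suc a ≤ 2 ^ a
1+n≤2^n zero    = s≤s z≤n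
1+n≤2^n (suc a) = +-mono-≤ (≤-trans (s≤s z≤n) (1+n≤2^n a))
                           (≤-trans (1+n≤2^n a) (≤-reflexive (sym (+-identityʳ (2 ^ a)))))

-- A prime power q ^ a with q ≥ 2 ^ t pays for its divisor factor (a + 1) ^ t.
large-base-bound : ∀ t a b → 2 ^ t ≤ b → suc a ^ t ≤ b ^ a
large-base-bound t a b 2ᵗ≤b = begin
  suc a ^ t    ≤⟨ ^-monoˡ-≤ t (1+n≤2^n a) ⟩
  (2 ^ a) ^ t  ≡⟨ ^-*-assoc 2 a t ⟩
  2 ^ (a * t)  ≡⟨ cong (2 ^_) (*-comm a t) ⟩
  2 ^ (t * a)  ≡⟨ ^-*-assoc 2 t a ⟨
  (2 ^ t) ^ a  ≤⟨ ^-monoˡ-≤ a 2ᵗ≤b ⟩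
  b ^ a        ∎
  where open ≤-Reasoning

-- For any base b ≥ 2 the same holds up to the constant t ^ t.  Writing
-- a = r + Q t with r < t, we have a + 1 ≤ t (Q + 1) and (Q + 1) ^ t ≤ 2 ^ (t Q).
small-base-bound : ∀ t a b → .{{NonZero t}} → 2 ≤ b → suc a ^ t ≤ t ^ t * b ^ a
small-base-bound t a b 2≤b = begin
  suc a ^ t              ≤⟨ ^-monoˡ-≤ t 1+a≤t[1+Q] ⟩
  (t * suc Q) ^ t        ≡⟨ *-^ t (suc Q) t ⟩
  t ^ t * suc Q ^ t      ≤⟨ *-monoʳ-≤ (t ^ t) (large-base-bound t Q (2 ^ t) ≤-refl) ⟩
  t ^ t * (2 ^ t) ^ Q    ≡⟨ cong (t ^ t *_) (^-*-assoc 2 t Q) ⟩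
  t ^ t * 2 ^ (t * Q)    ≤⟨ *-monoʳ-≤ (t ^ t) (^-monoʳ-≤ 2 tQ≤a) ⟩
  t ^ t * 2 ^ a          ≤⟨ *-monoʳ-≤ (t ^ t) (^-monoˡ-≤ a 2≤b) ⟩
  t ^ t * b ^ a          ∎
  where
  open ≤-Reasoning
  Q = a / t
  a≡r+Qt : a ≡ a % t + Q * t
  a≡r+Qt = m≡m%n+[m/n]*n a t
  tQ≤a : t * Q ≤ a
  tQ≤a = begin
    t * Q          ≡⟨ *-comm t Q ⟩
    Q * t          ≤⟨ m≤n+m (Q * t) (a % t) ⟩
    a % t + Q * t  ≡⟨ a≡r+Qt ⟨
    a              ∎
  1+a≤t[1+Q] : suc a ≤ t * suc Q
  1+a≤t[1+Q] = begin
    suc a              ≡⟨ cong suc a≡r+Qt ⟩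
    suc (a % t) + Q * t ≤⟨ +-monoˡ-≤ (Q * t) (m%n<n a t) ⟩
    t + Q * t          ≡⟨ *-comm t (suc Q) ⟨
    t * suc Q          ∎

-- Scanning b, b + 1, … for a divisor of a b-rough n > 1: the first divisor q
-- found leaves n q-rough (so q is its least prime factor).
leastFactor : ∀ G b n → .{{NonTrivial n}} → n ≤ b + G → b Rough n →
              ∃ λ q → b ≤ q × q ∣ n × q Rough n
leastFactor G b n n≤b+G b-rough with b ∣? n
... | yes b∣n = b , ≤-refl , b∣n , b-rough
leastFactor zero    b n n≤b+G b-rough | no b∤n =
  contradiction (subst (_∣ n) (≤-antisym (subst (n ≤_) (+-identityʳ b) n≤b+G) (rough⇒≤ b-rough)) ∣-refl) b∤n
leastFactor (suc G) b n n≤b+G b-rough | no b∤n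
  with leastFactor G (suc b) n (subst (n ≤_) (+-suc b G) n≤b+G) (∤⇒rough-suc b∤n b-rough)
... | q , b<q , q∣n , q-rough = q , ≤-trans (n≤1+n b) b<q , q∣n , q-rough

divisorConstant : ℕ → ℕ
divisorConstant t = (t ^ t) ^ (2 ^ t)

module DivisorBound (t : ℕ) .{{_ : NonZero t}} where

  c : ℕ
  c = t ^ t

  instance
    c≢0 : NonZero c
    c≢0 = m^n≢0 t t

  -- Only primes below 2 ^ t cost a factor c; E b bounds how many remain once
  -- all primes below b have been removed.
  E : ℕ → ℕ
  E b = 2 ^ t ∸ b

  -- Removing the prime power b ^ a costs at most the factor c that is gained
  -- by lowering the threshold from b + 1 to b.
  prime-power-step : ∀ a b → 2 ≤ b → suc a ^ t * c ^ E (suc b) ≤ c ^ E b * b ^ a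
  prime-power-step a b 2≤b with 2 ^ t ≤? b
  ... | yes 2ᵗ≤b = begin
    suc a ^ t * c ^ E (suc b) ≡⟨ cong (λ e → suc a ^ t * c ^ e) (m≤n⇒m∸n≡0 (m≤n⇒m≤1+n 2ᵗ≤b)) ⟩
    suc a ^ t * 1             ≡⟨ *-identityʳ (suc a ^ t) ⟩
    suc a ^ t                 ≤⟨ large-base-bound t a b 2ᵗ≤b ⟩
    b ^ a                     ≡⟨ *-identityˡ (b ^ a) ⟨
    1 * b ^ a                 ≡⟨ cong (λ e → c ^ e * b ^ a) (m≤n⇒m∸n≡0 2ᵗ≤b) ⟨
    c ^ E b * b ^ a           ∎
    where open ≤-Reasoning
  ... | no 2ᵗ≰b = begin
    suc a ^ t * c ^ E (suc b)  ≤⟨ *-monoˡ-≤ (c ^ E (suc b)) (small-base-bound t a b 2≤b) ⟩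
    c * b ^ a * c ^ E (suc b)  ≡⟨ rearrange c (b ^ a) (c ^ E (suc b)) ⟩
    c ^ suc (E (suc b)) * b ^ a ≡⟨ cong (λ e → c ^ e * b ^ a) (+-∸-assoc 1 (≰⇒> 2ᵗ≰b)) ⟨
    c ^ E b * b ^ a            ∎
    where
    open ≤-Reasoning
    rearrange : ∀ x y z → x * y * z ≡ x * z * y
    rearrange = solve-∀

  -- Induction on n, removing its least prime factor q ≥ b: if n = q ^ a * m
  -- with q ∤ m, then m is (q + 1)-rough, τ n ≤ (a + 1) τ m, and the factor
  -- (a + 1) ^ t is paid for by prime-power-step.
  rough-bound : ∀ n → .{{NonZero n}} → ∀ b → 2 ≤ b → b Rough n → τ n ^ t ≤ c ^ E b * n
  rough-bound = <-rec (λ n → .{{NonZero n}} → ∀ b → 2 ≤ b → b Rough n → τ n ^ t ≤ c ^ E b * n) step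
    where
    step : ∀ n → (∀ {m} → m < n → .{{NonZero m}} → ∀ b → 2 ≤ b → b Rough m → τ m ^ t ≤ c ^ E b * m) →
           .{{NonZero n}} → ∀ b → 2 ≤ b → b Rough n → τ n ^ t ≤ c ^ E b * n
    step 1 _ b _ _ = begin
      1 ^ t       ≡⟨ ^-zeroˡ t ⟩
      1           ≤⟨ m^n>0 c (E b) ⟩
      c ^ E b     ≡⟨ *-identityʳ (c ^ E b) ⟨
      c ^ E b * 1 ∎
      where open ≤-Reasoning
    step n@(suc (suc _)) rec b 2≤b b-rough with leastFactor n b n (m≤n+m n b) b-rough
    ... | q , b≤q , q∣n , q-rough with factorOut q (≤-trans 2≤b b≤q) n
    ... | a , m , n≡qᵃm , q∤m = begin
      τ n ^ t                          ≡⟨ cong (λ x → τ x ^ t) n≡qᵃm ⟩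
      τ (q ^ a * m) ^ t                ≤⟨ ^-monoˡ-≤ t (τ-prime-power a m q-prime q∤m) ⟩
      (suc a * τ m) ^ t                ≡⟨ *-^ (suc a) (τ m) t ⟩
      suc a ^ t * τ m ^ t              ≤⟨ *-monoʳ-≤ (suc a ^ t) (rec m<n (suc q) (m≤n⇒m≤1+n 2≤q) m-rough) ⟩
      suc a ^ t * (c ^ E (suc q) * m)  ≡⟨ *-assoc (suc a ^ t) (c ^ E (suc q)) m ⟨
      suc a ^ t * c ^ E (suc q) * m    ≤⟨ *-monoˡ-≤ m (prime-power-step a q 2≤q) ⟩
      c ^ E q * q ^ a * m              ≡⟨ *-assoc (c ^ E q) (q ^ a) m ⟩
      c ^ E q * (q ^ a * m)            ≡⟨ cong (c ^ E q *_) n≡qᵃm ⟨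
      c ^ E q * n                      ≤⟨ *-monoˡ-≤ n (^-monoʳ-≤ c (∸-monoʳ-≤ (2 ^ t) b≤q)) ⟩
      c ^ E b * n                      ∎
      where
      open ≤-Reasoning
      2≤q = ≤-trans 2≤b b≤q
      q-prime = rough∧∣⇒prime {{n>1⇒nonTrivial 2≤q}} q-rough q∣n
      m∣n : m ∣ n
      m∣n = subst (m ∣_) (sym n≡qᵃm) (n∣m*n (q ^ a))
      instance
        m≢0 : NonZero m
        m≢0 = ≢-nonZero λ m≡0 → ≢-nonZero⁻¹ n (0∣⇒≡0 (subst (_∣ n) m≡0 m∣n))
      m<n : m < n
      m<n = ≤∧≢⇒< (∣⇒≤ m∣n) (λ m≡n → q∤m (subst (q ∣_) (sym m≡n) q∣n))
      m-rough : suc q Rough m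
      m-rough = ∤⇒rough-suc q∤m (rough∧∣⇒rough q-rough m∣n)

τ-bound : ∀ t .{{_ : NonZero t}} n .{{_ : NonZero n}} → τ n ^ t ≤ divisorConstant t * n
τ-bound t n = ≤-trans (rough-bound n 2 ≤-refl 2-rough)
                      (*-monoˡ-≤ n (^-monoʳ-≤ c (m∸n≤m (2 ^ t) 2)))
  where open DivisorBound t

-- Congruences modulo p, stated without subtraction: a + u p = b + v p.

infix 4 _≡_mod_
_≡_mod_ : ℕ → ℕ → ℕ → Set
a ≡ b mod p = ∃₂ λ u v → a + u * p ≡ b + v * p

module _ {p : ℕ} where

  ≡⇒≡-mod : ∀ {a b} → a ≡ b → a ≡ b mod p
  ≡⇒≡-mod refl = 0 , 0 , refl

  ≡-mod-sym : ∀ {a b} → a ≡ b mod p → b ≡ a mod p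
  ≡-mod-sym (u , v , eq) = v , u , sym eq

  ≡-mod-trans : ∀ {a b c} → a ≡ b mod p → b ≡ c mod p → a ≡ c mod p
  ≡-mod-trans {a} {b} {c} (u , v , eq₁) (u′ , v′ , eq₂) = u + u′ , v′ + v , (begin
    a + (u + u′) * p      ≡⟨ regroup a u u′ p ⟩
    (a + u * p) + u′ * p  ≡⟨ cong (_+ u′ * p) eq₁ ⟩
    (b + v * p) + u′ * p  ≡⟨ swap b v u′ p ⟩
    (b + u′ * p) + v * p  ≡⟨ cong (_+ v * p) eq₂ ⟩
    (c + v′ * p) + v * p  ≡⟨ regroup c v′ v p ⟨
    c + (v′ + v) * p      ∎)
    where
    open ≡-Reasoning
    regroup : ∀ a u u′ p → a + (u + u′) * p ≡ (a + u * p) + u′ * p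
    regroup = solve-∀
    swap : ∀ b v u′ p → (b + v * p) + u′ * p ≡ (b + u′ * p) + v * p
    swap = solve-∀

  +-cong-mod : ∀ {a b c d} → a ≡ b mod p → c ≡ d mod p → a + c ≡ b + d mod p
  +-cong-mod {a} {b} {c} {d} (u , v , eq₁) (u′ , v′ , eq₂) = u + u′ , v + v′ , (begin
    (a + c) + (u + u′) * p       ≡⟨ interchange a c u u′ p ⟩
    (a + u * p) + (c + u′ * p)   ≡⟨ cong₂ _+_ eq₁ eq₂ ⟩
    (b + v * p) + (d + v′ * p)   ≡⟨ interchange b d v v′ p ⟨
    (b + d) + (v + v′) * p       ∎)
    where
    open ≡-Reasoning
    interchange : ∀ a c u u′ p → (a + c) + (u + u′) * p ≡ (a + u * p) + (c + u′ * p)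
    interchange = solve-∀

  *-cong-mod : ∀ k {a b} → a ≡ b mod p → k * a ≡ k * b mod p
  *-cong-mod k {a} {b} (u , v , eq) = k * u , k * v , (begin
    k * a + k * u * p  ≡⟨ distrib k a u p ⟩
    k * (a + u * p)    ≡⟨ cong (k *_) eq ⟩
    k * (b + v * p)    ≡⟨ distrib k b v p ⟨
    k * b + k * v * p  ∎)
    where
    open ≡-Reasoning
    distrib : ∀ k a u p → k * a + k * u * p ≡ k * (a + u * p)
    distrib = solve-∀

  +-cancelˡ-mod : ∀ c {a b} → c + a ≡ c + b mod p → a ≡ b mod p
  +-cancelˡ-mod c {a} {b} (u , v , eq) =
    u , v , +-cancelˡ-≡ c _ _ (trans (sym (+-assoc c a _)) (trans eq (+-assoc c b _)))

  p≡0-mod : p ≡ 0 mod p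
  p≡0-mod = 0 , 1 , trans (+-identityʳ p) (sym (+-identityʳ p))

  ≡-mod-setoid : Setoid _ _
  ≡-mod-setoid = record
    { Carrier       = ℕ
    ; _≈_           = (λ a b → a ≡ b mod p)
    ; isEquivalence = record { refl = ≡⇒≡-mod refl ; sym = ≡-mod-sym ; trans = ≡-mod-trans }
    }

  module ≡-mod-Reasoning = SetoidReasoning ≡-mod-setoid

  module _ .{{_ : NonZero p}} where

    %⇒≡-mod : ∀ {a b} → a % p ≡ b % p → a ≡ b mod p
    %⇒≡-mod {a} {b} eq = b / p , a / p , (begin
      a + b / p * p                  ≡⟨ cong (_+ b / p * p) (m≡m%n+[m/n]*n a p) ⟩
      a % p + a / p * p + b / p * p  ≡⟨ cong (λ x → x + a / p * p + b / p * p) eq ⟩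
      b % p + a / p * p + b / p * p  ≡⟨ swap (b % p) (a / p * p) (b / p * p) ⟩
      b % p + b / p * p + a / p * p  ≡⟨ cong (_+ a / p * p) (m≡m%n+[m/n]*n b p) ⟨
      b + a / p * p                  ∎)
      where
      open ≡-Reasoning
      swap : ∀ x y z → x + y + z ≡ x + z + y
      swap = solve-∀

    ≡-mod⇒% : ∀ {a b} → a ≡ b mod p → a % p ≡ b % p
    ≡-mod⇒% {a} {b} (u , v , eq) =
      trans (sym ([m+kn]%n≡m%n a u p)) (trans (cong (_% p) eq) ([m+kn]%n≡m%n b v p))

    ≡-mod-% : ∀ a → a ≡ a % p mod p
    ≡-mod-% a = %⇒≡-mod (sym (m%n%n≡m%n a p))

sameBox⇒close : ∀ {p} .{{_ : NonZero p}} T x y → y ≤ x → x * T / p ≡ y * T / p → (x ∸ y) * T < p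
sameBox⇒close {p} T x y y≤x same = ≰⇒> λ p≤[x∸y]T → <⇒≢ (different-boxes p≤[x∸y]T) (sym same)
  where
  open ≤-Reasoning
  different-boxes : p ≤ (x ∸ y) * T → y * T / p < x * T / p
  different-boxes p≤[x∸y]T = begin-strict
    y * T / p                 <⟨ n<1+n _ ⟩
    suc (y * T / p)           ≡⟨ cong (λ m → suc (m / p)) (m+n∸n≡m (y * T) p) ⟨
    suc ((y * T + p ∸ p) / p) ≡⟨ m/n≡1+[m∸n]/n (m≤n+m p (y * T)) ⟨
    (y * T + p) / p           ≤⟨ /-monoˡ-≤ p (+-monoʳ-≤ (y * T) p≤[x∸y]T) ⟩
    (y * T + (x ∸ y) * T) / p ≡⟨ cong (_/ p) (*-distribʳ-+ T y (x ∸ y)) ⟨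
    (y + (x ∸ y)) * T / p     ≡⟨ cong (λ m → m * T / p) (m+[n∸m]≡n y≤x) ⟩
    x * T / p                 ∎

-- An approximation of B / p with denominator at most T: a multiple r B
-- (1 ≤ r ≤ T) that is congruent to s or to - s with s T < p.
Approximation : ℕ → ℕ → ℕ → Set
Approximation p B T =
  ∃ λ r → (1 ≤ r × r ≤ T) × ∃ λ s → s * T < p × (r * B ≡ s mod p ⊎ r * B + s ≡ 0 mod p)

collision⇒approximation : ∀ p B T → .{{_ : NonZero p}} → ∀ a b → a < b → b ≤ T →
                          (a * B % p) * T / p ≡ (b * B % p) * T / p → Approximation p B T
collision⇒approximation p B T a b a<b b≤T same = r , (1≤r , r≤T) , approx (y ≤? x)
  where
  open ≡-mod-Reasoning
  x = b * B % p
  y = a * B % p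
  r = b ∸ a
  1≤r : 1 ≤ r
  1≤r = m<n⇒0<n∸m a<b
  r≤T : r ≤ T
  r≤T = ≤-trans (m∸n≤m b a) b≤T
  y+rB≡x : y + r * B ≡ x mod p
  y+rB≡x = begin
    y + r * B      ≈⟨ +-cong-mod (≡-mod-% (a * B)) (≡⇒≡-mod refl) ⟨
    a * B + r * B  ≡⟨ *-distribʳ-+ B a r ⟨
    (a + r) * B    ≡⟨ cong (_* B) (m+[n∸m]≡n (<⇒≤ a<b)) ⟩
    b * B          ≈⟨ ≡-mod-% (b * B) ⟩
    x              ∎
  approx : Dec (y ≤ x) → ∃ λ s → s * T < p × (r * B ≡ s mod p ⊎ r * B + s ≡ 0 mod p)
  approx (yes y≤x) = x ∸ y , sameBox⇒close T x y y≤x (sym same) , inj₁ (+-cancelˡ-mod y (begin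
    y + r * B      ≈⟨ y+rB≡x ⟩
    x              ≡⟨ m+[n∸m]≡n y≤x ⟨
    y + (x ∸ y)    ∎))
  approx (no y≰x) = y ∸ x , sameBox⇒close T y x x≤y same , inj₂ (+-cancelˡ-mod y (begin
    y + (r * B + (y ∸ x))  ≡⟨ +-assoc y (r * B) (y ∸ x) ⟨
    y + r * B + (y ∸ x)    ≈⟨ +-cong-mod y+rB≡x (≡⇒≡-mod refl) ⟩
    x + (y ∸ x)            ≡⟨ m+[n∸m]≡n x≤y ⟩
    y                      ≡⟨ +-identityʳ y ⟨
    y + 0                  ∎))
    where
    x≤y = <⇒≤ (≰⇒> y≰x)

-- Pigeonhole: the T + 1 residues of 0, B, …, T B fall into T boxes of width p / T.
dirichlet : ∀ p B T → .{{_ : NonZero p}} → .{{_ : NonZero T}} → Approximation p B T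
dirichlet p B T = collide (pigeonhole ≤-refl box)
  where
  box< : ∀ a → (a * B % p) * T / p < T
  box< a = m<n*o⇒m/o<n (≤-trans (*-monoˡ-< T (m%n<n (a * B) p)) (≤-reflexive (*-comm p T)))
  box : Fin (suc T) → Fin T
  box i = fromℕ< (box< (toℕ i))
  collide : ∃₂ (λ i j → i Fin.< j × box i ≡ box j) → Approximation p B T
  collide (i , j , i<j , same-box) = collision⇒approximation p B T (toℕ i) (toℕ j) i<j
    (≤-pred (toℕ<n j)) (trans (sym (toℕ-fromℕ< _)) (trans (cong toℕ same-box) (toℕ-fromℕ< _)))

multiple⇒divisor : ∀ {p} .{{_ : NonZero p}} z e x T K → x < p → z * e ≡ x mod p →
                   z * e * T ≤ K * p → ∃ λ j → j * T ≤ K × z ∣ x + j * p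
multiple⇒divisor {p} z e x T K x<p ze≡x ze[T]≤Kp = j , jT≤K , subst (z ∣_) ze≡x+jp (m∣m*n e)
  where
  j = z * e / p
  ze≡x+jp : z * e ≡ x + j * p
  ze≡x+jp = trans (m≡m%n+[m/n]*n (z * e) p)
                  (cong (_+ j * p) (trans (≡-mod⇒% ze≡x) (m<n⇒m%n≡m x<p)))
  jT≤K : j * T ≤ K
  jT≤K = *-cancelʳ-≤ (j * T) K p (begin
    j * T * p  ≡⟨ swap j T p ⟩
    j * p * T  ≤⟨ *-monoˡ-≤ T (m/n*n≤m (z * e) p) ⟩
    z * e * T  ≤⟨ ze[T]≤Kp ⟩
    K * p      ∎)
    where
    open ≤-Reasoning
    swap : ∀ a b c → a * b * c ≡ a * c * b
    swap = solve-∀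

-- For fixed z a solution y is unique: (y₂ - y₁) z ≡ 0 (mod p) with
-- 0 < z < p and 0 ≤ y₂ - y₁ < p forces y₁ = y₂.
module _ {p B L M : ℕ} .{{_ : NonZero p}} (p-prime : Prime p) (B+L<p : B + L < p) (M<p : M < p) where

  private
    ≡0-mod⇒∣ : ∀ {x} → x ≡ 0 mod p → p ∣ x
    ≡0-mod⇒∣ {x} x≡0 = m%n≡0⇒n∣m x p (trans (≡-mod⇒% {p = p} x≡0) (m<n⇒m%n≡m (>-nonZero⁻¹ p)))

    ∣-small⇒≡0 : ∀ {x} → p ∣ x → x < p → x ≡ 0
    ∣-small⇒≡0 {zero}  _   _   = refl
    ∣-small⇒≡0 {suc x} p∣x x<p = contradiction (∣⇒≤ p∣x) (<⇒≱ x<p)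

    ordered : ∀ {y₁ y₂ z} → y₁ ≤ y₂ → y₂ ≤ L → 1 ≤ z → z ≤ M →
              (B + y₁) * z ≡ 1 mod p → (B + y₂) * z ≡ 1 mod p → y₁ ≡ y₂
    ordered {y₁} {y₂} {z} y₁≤y₂ y₂≤L 1≤z z≤M sol₁ sol₂ = cases (euclidsLemma d z p-prime (≡0-mod⇒∣ dz≡0))
      where
      open ≡-mod-Reasoning
      d = y₂ ∸ y₁
      dz≡0 : d * z ≡ 0 mod p
      dz≡0 = +-cancelˡ-mod ((B + y₁) * z) (begin
        (B + y₁) * z + d * z  ≡⟨ *-distribʳ-+ z (B + y₁) d ⟨
        (B + y₁ + d) * z      ≡⟨ cong (_* z) (trans (+-assoc B y₁ d) (cong (B +_) (m+[n∸m]≡n y₁≤y₂))) ⟩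
        (B + y₂) * z          ≈⟨ sol₂ ⟩
        1                     ≈⟨ sol₁ ⟨
        (B + y₁) * z          ≡⟨ +-identityʳ ((B + y₁) * z) ⟨
        (B + y₁) * z + 0      ∎)
      cases : p ∣ d ⊎ p ∣ z → y₁ ≡ y₂
      cases (inj₁ p∣d) = trans (sym (+-identityʳ y₁)) (trans (cong (y₁ +_) (sym d≡0)) (m+[n∸m]≡n y₁≤y₂))
        where
        d≡0 = ∣-small⇒≡0 p∣d (≤-<-trans (≤-trans (m∸n≤m y₂ y₁) (≤-trans y₂≤L (m≤n+m L B))) B+L<p)
      cases (inj₂ p∣z) = contradiction (∣-small⇒≡0 p∣z (≤-<-trans z≤M M<p)) (≢-nonZero⁻¹ z {{>-nonZero 1≤z}})

  solution-unique : ∀ {y₁ y₂ z} → y₁ ≤ L → y₂ ≤ L → 1 ≤ z → z ≤ M →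
                    (B + y₁) * z ≡ 1 mod p → (B + y₂) * z ≡ 1 mod p → y₁ ≡ y₂
  solution-unique {y₁} {y₂} y₁≤L y₂≤L 1≤z z≤M sol₁ sol₂ with ≤-total y₁ y₂
  ... | inj₁ y₁≤y₂ = ordered y₁≤y₂ y₂≤L 1≤z z≤M sol₁ sol₂
  ... | inj₂ y₂≤y₁ = sym (ordered y₂≤y₁ y₁≤L 1≤z z≤M sol₂ sol₁)

module FromApproximation
  (p B L T : ℕ) .{{_ : NonZero p}} (T²L≤p : T * T * L ≤ p)
  (r : ℕ) (1≤r : 1 ≤ r) (r≤T : r ≤ T) (r<p : r < p) (s : ℕ) (sT<p : s * T < p) where

  ryT≤p : ∀ y → y ≤ L → r * y * T ≤ p
  ryT≤p y y≤L = begin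
    r * y * T  ≤⟨ *-monoˡ-≤ T (*-mono-≤ r≤T y≤L) ⟩
    T * L * T  ≡⟨ swap T L ⟩
    T * T * L  ≤⟨ T²L≤p ⟩
    p          ∎
    where
    open ≤-Reasoning
    swap : ∀ T L → T * L * T ≡ T * T * L
    swap = solve-∀

  scaled-solution : ∀ y z → (B + y) * z ≡ 1 mod p → r * B * z + r * y * z ≡ r mod p
  scaled-solution y z sol = begin
    r * B * z + r * y * z  ≡⟨ distrib r B y z ⟩
    r * ((B + y) * z)      ≈⟨ *-cong-mod r sol ⟩
    r * 1                  ≡⟨ *-identityʳ r ⟩
    r                      ∎
    where
    open ≡-mod-Reasoning
    distrib : ∀ r B y z → r * B * z + r * y * z ≡ r * ((B + y) * z)
    distrib = solve-∀

  ShortMultiple : ℕ → Set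
  ShortMultiple z = ∃ λ e → e * T ≤ 2 * p × (z * e ≡ r mod p ⊎ z * e ≡ p ∸ r mod p)

  shortMultiple₊ : ∀ y z → y ≤ L → (B + y) * z ≡ 1 mod p → r * B ≡ s mod p → ShortMultiple z
  shortMultiple₊ y z y≤L sol rB≡s = s + r * y , eT≤2p , inj₁ (begin
    z * (s + r * y)        ≡⟨ distrib z s r y ⟩
    z * s + r * y * z      ≈⟨ +-cong-mod (*-cong-mod z rB≡s) (≡⇒≡-mod refl) ⟨
    z * (r * B) + r * y * z ≡⟨ cong (_+ r * y * z) (*-comm z (r * B)) ⟩
    r * B * z + r * y * z  ≈⟨ scaled-solution y z sol ⟩
    r                      ∎)
    where
    open ≡-mod-Reasoning
    distrib : ∀ z s r y → z * (s + r * y) ≡ z * s + r * y * z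
    distrib = solve-∀
    eT≤2p : (s + r * y) * T ≤ 2 * p
    eT≤2p = ≤-trans (≤-reflexive (*-distribʳ-+ T s (r * y)))
                    (≤-trans (+-mono-≤ (<⇒≤ sT<p) (ryT≤p y y≤L)) (≤-reflexive (cong (p +_) (sym (+-identityʳ p)))))

  -- Case r B + s ≡ 0: then r y z ≡ r + s z, and e = ∣ r y - s ∣ works.
  shortMultiple₋ : ∀ y z → y ≤ L → (B + y) * z ≡ 1 mod p → r * B + s ≡ 0 mod p → ShortMultiple z
  shortMultiple₋ y z y≤L sol rB+s≡0 = cases (s ≤? r * y)
    where
    open ≡-mod-Reasoning
    p≤2p : p ≤ 2 * p
    p≤2p = m≤m+n p (p + 0)
    ryz≡r+sz : r * y * z ≡ r + s * z mod p
    ryz≡r+sz = begin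
      r * y * z                        ≡⟨ cong (_+ r * y * z) (*-zeroʳ z) ⟨
      z * 0 + r * y * z                ≈⟨ +-cong-mod (*-cong-mod z rB+s≡0) (≡⇒≡-mod refl) ⟨
      z * (r * B + s) + r * y * z      ≡⟨ regroup z r B s y ⟩
      (r * B * z + r * y * z) + s * z  ≈⟨ +-cong-mod (scaled-solution y z sol) (≡⇒≡-mod refl) ⟩
      r + s * z                        ∎
      where
      regroup : ∀ z r B s y → z * (r * B + s) + r * y * z ≡ (r * B * z + r * y * z) + s * z
      regroup = solve-∀
    cases : Dec (s ≤ r * y) → ShortMultiple z
    cases (yes s≤ry) = r * y ∸ s , ≤-trans (*-monoˡ-≤ T (m∸n≤m (r * y) s)) (≤-trans (ryT≤p y y≤L) p≤2p) ,
      inj₁ (+-cancelˡ-mod (s * z) (begin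
        s * z + z * (r * y ∸ s)  ≡⟨ cong (s * z +_) (*-comm z (r * y ∸ s)) ⟩
        s * z + (r * y ∸ s) * z  ≡⟨ *-distribʳ-+ z s (r * y ∸ s) ⟨
        (s + (r * y ∸ s)) * z    ≡⟨ cong (_* z) (m+[n∸m]≡n s≤ry) ⟩
        r * y * z                ≈⟨ ryz≡r+sz ⟩
        r + s * z                ≡⟨ +-comm r (s * z) ⟩
        s * z + r                ∎))
    cases (no s≰ry) = s ∸ r * y , ≤-trans (*-monoˡ-≤ T (m∸n≤m s (r * y))) (≤-trans (<⇒≤ sT<p) p≤2p) ,
      inj₂ (+-cancelˡ-mod r (begin
        r + z * e    ≈⟨ r+ze≡0 ⟩
        0            ≈⟨ p≡0-mod ⟨
        p            ≡⟨ m+[n∸m]≡n (<⇒≤ r<p) ⟨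
        r + (p ∸ r)  ∎))
      where
      e = s ∸ r * y
      ry≤s = <⇒≤ (≰⇒> s≰ry)
      r+ze≡0 : r + z * e ≡ 0 mod p
      r+ze≡0 = +-cancelˡ-mod (r * y * z) (begin
        r * y * z + (r + z * e)  ≡⟨ regroup r y z e ⟩
        r + (r * y + e) * z      ≡⟨ cong (λ w → r + w * z) (m+[n∸m]≡n ry≤s) ⟩
        r + s * z                ≈⟨ ryz≡r+sz ⟨
        r * y * z                ≡⟨ +-identityʳ (r * y * z) ⟨
        r * y * z + 0            ∎)
        where
        regroup : ∀ r y z e → r * y * z + (r + z * e) ≡ r + (r * y + e) * z
        regroup = solve-∀

  solution⇒divisor : ∀ M y z → y ≤ L → z ≤ M → (B + y) * z ≡ 1 mod p →
                     r * B ≡ s mod p ⊎ r * B + s ≡ 0 mod p →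
                     ∃ λ j → j * T ≤ 2 * M × (z ∣ r + j * p ⊎ z ∣ (p ∸ r) + j * p)
  solution⇒divisor M y z y≤L z≤M sol approx = divisor (shortMultiple approx)
    where
    shortMultiple : r * B ≡ s mod p ⊎ r * B + s ≡ 0 mod p → ShortMultiple z
    shortMultiple (inj₁ rB≡s)   = shortMultiple₊ y z y≤L sol rB≡s
    shortMultiple (inj₂ rB+s≡0) = shortMultiple₋ y z y≤L sol rB+s≡0
    bound : ∀ e → e * T ≤ 2 * p → z * e * T ≤ 2 * M * p
    bound e eT≤2p = begin
      z * e * T      ≡⟨ *-assoc z e T ⟩
      z * (e * T)    ≤⟨ *-mono-≤ z≤M eT≤2p ⟩
      M * (2 * p)    ≡⟨ swap M p ⟩
      2 * M * p      ∎
      where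
      open ≤-Reasoning
      swap : ∀ M p → M * (2 * p) ≡ 2 * M * p
      swap = solve-∀
    divisor : ShortMultiple z → ∃ λ j → j * T ≤ 2 * M × (z ∣ r + j * p ⊎ z ∣ (p ∸ r) + j * p)
    divisor (e , eT≤2p , inj₁ ze≡r) =
      map₂ (map₂ inj₁) (multiple⇒divisor z e r T (2 * M) r<p ze≡r (bound e eT≤2p))
    divisor (e , eT≤2p , inj₂ ze≡p∸r) =
      map₂ (map₂ inj₂) (multiple⇒divisor z e (p ∸ r) T (2 * M) (∸-monoʳ-< 1≤r (<⇒≤ r<p)) ze≡p∸r (bound e eT≤2p))

  block : ℕ → List ℕ
  block j = divisors (r + j * p) ++ divisors ((p ∸ r) + j * p)

  candidates : ℕ → List ℕ
  candidates J = concatMap block (upTo (suc J))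

  ∈-candidates : ∀ {z j} J → j ≤ J → z ∣ r + j * p ⊎ z ∣ (p ∸ r) + j * p → z ∈ candidates J
  ∈-candidates {z} {j} J j≤J z∣ = ∈-concatMap⁺ block (lose (∈-upTo⁺ (s≤s j≤J)) (∈-block z∣))
    where
    ∈-block : z ∣ r + j * p ⊎ z ∣ (p ∸ r) + j * p → z ∈ block j
    ∈-block (inj₁ z∣) = ∈-++⁺ˡ (∈-divisors⁺ {{>-nonZero (≤-trans 1≤r (m≤m+n r (j * p)))}} z∣)
    ∈-block (inj₂ z∣) = ∈-++⁺ʳ (divisors (r + j * p))
      (∈-divisors⁺ {{>-nonZero (≤-trans (m<n⇒0<n∸m r<p) (m≤m+n (p ∸ r) (j * p)))}} z∣)

  candidates-length : ∀ J D → (∀ j → j ≤ J → τ (r + j * p) ≤ D × τ ((p ∸ r) + j * p) ≤ D) →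
                      length (candidates J) ≤ suc J * (D + D)
  candidates-length J D τ≤D = begin
    length (candidates J)          ≤⟨ length-concatMap-≤ block (upTo (suc J)) (D + D) block-length ⟩
    length (upTo (suc J)) * (D + D) ≡⟨ cong (_* (D + D)) (length-upTo (suc J)) ⟩
    suc J * (D + D)                ∎
    where
    open ≤-Reasoning
    block-length : ∀ {j} → j ∈ upTo (suc J) → length (block j) ≤ D + D
    block-length {j} j∈ with τ≤D j (≤-pred (∈-upTo⁻ j∈))
    ... | τ₁≤D , τ₂≤D = ≤-trans (≤-reflexive (length-++ (divisors (r + j * p)))) (+-mono-≤ τ₁≤D τ₂≤D)

  -- Counting: z determines the solution (solution-unique) and lies among the
  -- candidates with J = ⌊2 M / T⌋, so a filter of range1 L × range1 M that
  -- only accepts solutions keeps at most length (candidates J) pairs.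
  solutions≤candidates : ∀ M → .{{_ : NonZero T}} → Prime p → B + L < p → M < p →
    r * B ≡ s mod p ⊎ r * B + s ≡ 0 mod p →
    (f : ℕ × ℕ → Bool) → (∀ y z → IsTrue (f (y , z)) → (B + y) * z ≡ 1 mod p) →
    length (filterᵇ f (cartesianProduct (range1 L) (range1 M))) ≤ length (candidates (2 * M / T))
  solutions≤candidates M p-prime B+L<p M<p approx f f⇒sol = begin
    length xs              ≡⟨ length-map proj₂ xs ⟨
    length (map proj₂ xs)  ≤⟨ unique-⊆-length (map proj₂ xs) (candidates J) zs-unique zs⊆candidates ⟩
    length (candidates J)  ∎
    where
    open ≤-Reasoning
    J = 2 * M / T
    xs = filterᵇ f (cartesianProduct (range1 L) (range1 M))
    Solution : ℕ × ℕ → Set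
    Solution (y , z) = (1 ≤ y × y ≤ L) × (1 ≤ z × z ≤ M) × (B + y) * z ≡ 1 mod p
    solution : ∀ {x} → x ∈ xs → Solution x
    solution {y , z} x∈ with ∈-filter⁻ _ {xs = cartesianProduct (range1 L) (range1 M)} x∈
    ... | x∈product , accepted with ∈-cartesianProduct⁻ (range1 L) (range1 M) x∈product
    ...   | y∈ , z∈ = ∈-range1⁻ y∈ , ∈-range1⁻ z∈ , f⇒sol y z accepted
    injective : ∀ {a b} → Solution a → Solution b → a ≢ b → proj₂ a ≢ proj₂ b
    injective {y₁ , z} {y₂ , .z} ((_ , y₁≤L) , (1≤z , z≤M) , sol₁) ((_ , y₂≤L) , _ , sol₂) a≢b refl =
      a≢b (cong (_, z) (solution-unique p-prime B+L<p M<p y₁≤L y₂≤L 1≤z z≤M sol₁ sol₂))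
    zs-unique : Unique (map proj₂ xs)
    zs-unique = map-unique proj₂ Solution xs (All.tabulate solution)
      (Unique.filter⁺ _ (Unique.cartesianProduct⁺ (range1-unique L) (range1-unique M))) injective
    zs⊆candidates : ∀ {z} → z ∈ map proj₂ xs → z ∈ candidates J
    zs⊆candidates z∈ with ∈-map⁻ proj₂ z∈
    ... | (y , z) , x∈ , refl with solution x∈
    ...   | (_ , y≤L) , (_ , z≤M) , sol with solution⇒divisor M y z y≤L z≤M sol approx
    ...     | j , jT≤2M , z∣ = ∈-candidates J (≤-trans (≤-reflexive (sym (m*n/n≡m j T))) (/-monoˡ-≤ T jT≤2M)) z∣

square≤⇒< : ∀ {T p} → 2 ≤ p → T * T ≤ p → T < p
square≤⇒< {T} {p} 2≤p T²≤p = ≰⇒> λ p≤T → <⇒≱ 2≤p (*-cancelˡ-≤ p {{>-nonZero (≤-trans (s≤s z≤n) 2≤p)}} (begin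
  p * p  ≤⟨ *-mono-≤ p≤T p≤T ⟩
  T * T  ≤⟨ T²≤p ⟩
  p      ≡⟨ *-identityʳ p ⟨
  p * 1  ∎))
  where open ≤-Reasoning

candidate≤3p² : ∀ {p x j} → 1 ≤ p → x ≤ p → j ≤ 2 * p → x + j * p ≤ 3 * p * p
candidate≤3p² {p} {x} {j} 1≤p x≤p j≤2p = begin
  x + j * p           ≤⟨ +-mono-≤ (≤-trans x≤p (m≤m*n p p {{>-nonZero 1≤p}})) (*-monoˡ-≤ p j≤2p) ⟩
  p * p + 2 * p * p   ≡⟨ collect p ⟩
  3 * p * p           ∎
  where
  open ≤-Reasoning
  collect : ∀ p → p * p + 2 * p * p ≡ 3 * p * p
  collect = solve-∀

solCount-bound : ∀ p .{{_ : NonZero p}} → Prime p → ∀ B L M → 1 ≤ L → B + L < p → M < p →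
                 ∀ T .{{_ : NonZero T}} → T * T * L ≤ p →
                 ∀ D → (∀ n → 1 ≤ n → n ≤ 3 * p * p → τ n ≤ D) →
                 solCount p B L M ≤ suc (2 * M / T) * (D + D)
solCount-bound p p-prime B L M 1≤L B+L<p M<p T T²L≤p D τ≤D with dirichlet p B T
... | r , (1≤r , r≤T) , s , sT<p , approx = begin
  solCount p B L M       ≤⟨ solutions≤candidates M p-prime B+L<p M<p approx _
                              (λ y z accepted → %⇒≡-mod (≡ᵇ⇒≡ _ _ accepted)) ⟩
  length (candidates J)  ≤⟨ candidates-length J D candidates-τ≤D ⟩
  suc J * (D + D)        ∎
  where
  open ≤-Reasoning
  J = 2 * M / T
  1≤p = ≤-trans (s≤s z≤n) (prime⇒2≤ p-prime)
  r<p : r < p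
  r<p = ≤-<-trans r≤T (square≤⇒< (prime⇒2≤ p-prime) (≤-trans (m≤m*n (T * T) L {{>-nonZero 1≤L}}) T²L≤p))
  open FromApproximation p B L T T²L≤p r 1≤r r≤T r<p s sT<p
  candidates-τ≤D : ∀ j → j ≤ J → τ (r + j * p) ≤ D × τ ((p ∸ r) + j * p) ≤ D
  candidates-τ≤D j j≤J = τ≤D _ (≤-trans 1≤r (m≤m+n r (j * p))) (candidate≤3p² 1≤p (<⇒≤ r<p) j≤2p)
                       , τ≤D _ (≤-trans (m<n⇒0<n∸m r<p) (m≤m+n (p ∸ r) (j * p))) (candidate≤3p² 1≤p (m∸n≤m p r) j≤2p)
    where
    j≤2p = ≤-trans j≤J (≤-trans (m/n≤m (2 * M) T) (*-monoʳ-≤ 2 (<⇒≤ M<p)))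

threshold : (f : ℕ → ℕ) (Q : ℕ) → f 0 ≤ Q → ∀ n → Q < f n → ∃ λ D → f D ≤ Q × Q < f (suc D)
threshold f Q f0≤Q zero    Q<f0 = contradiction f0≤Q (<⇒≱ Q<f0)
threshold f Q f0≤Q (suc n) Q<fn with f n ≤? Q
... | yes fn≤Q = n , fn≤Q , Q<fn
... | no  fn≰Q = threshold f Q f0≤Q n (≰⇒> fn≰Q)

-- The largest T with T ^ 2 L ≤ p; maximality gives p ≤ 4 T ^ 2 L.
choose-T : ∀ p L → 1 ≤ L → L ≤ p → ∃ λ T → 1 ≤ T × T * T * L ≤ p × p ≤ 4 * T * T * L
choose-T p L 1≤L L≤p = enlarge (threshold (λ x → suc x * suc x * L) p f[0]≤p p p<f[p])
  where
  f[0]≤p : 1 * 1 * L ≤ p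
  f[0]≤p = ≤-trans (≤-reflexive (+-identityʳ L)) L≤p
  p<f[p] : p < suc p * suc p * L
  p<f[p] = ≤-trans (m≤m*n (suc p) (suc p)) (m≤m*n (suc p * suc p) L {{>-nonZero 1≤L}})
  [T+1]²≤4T² : ∀ T₀ → suc (suc T₀) * suc (suc T₀) * L ≤ 4 * suc T₀ * suc T₀ * L
  [T+1]²≤4T² T₀ = ≤-trans (m≤m+n _ (3 * T₀ * T₀ * L + 4 * T₀ * L)) (≤-reflexive (expand T₀ L))
    where
    expand : ∀ T L → suc (suc T) * suc (suc T) * L + (3 * T * T * L + 4 * T * L) ≡ 4 * suc T * suc T * L
    expand = solve-∀
  enlarge : (∃ λ T₀ → suc T₀ * suc T₀ * L ≤ p × p < suc (suc T₀) * suc (suc T₀) * L) →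
            ∃ λ T → 1 ≤ T × T * T * L ≤ p × p ≤ 4 * T * T * L
  enlarge (T₀ , T²L≤p , p<[T+1]²L) = suc T₀ , s≤s z≤n , T²L≤p , ≤-trans (<⇒≤ p<[T+1]²L) ([T+1]²≤4T² T₀)

choose-root : ∀ t .{{_ : NonZero t}} Q → ∃ λ D → D ^ t ≤ Q × Q < suc D ^ t
choose-root t@(suc t′) Q = threshold (_^ t) Q z≤n (suc Q) (m≤m*n (suc Q) (suc Q ^ t′) {{m^n≢0 (suc Q) t′}})

^-double : ∀ x n → x ^ (2 * n) ≡ (x * x) ^ n
^-double x n = begin
  x ^ (2 * n)        ≡⟨ cong (λ m → x ^ (n + m)) (+-identityʳ n) ⟩
  x ^ (n + n)        ≡⟨ ^-distribˡ-+-* x n n ⟩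
  x ^ n * x ^ n      ≡⟨ *-^ x x n ⟨
  (x * x) ^ n        ∎
  where open ≡-Reasoning

pow-cancel : ∀ n x y → x ^ suc n ≤ y ^ suc n → x ≤ y
pow-cancel n x y xⁿ≤yⁿ = ≮⇒≥ λ y<x → <⇒≱ (^-monoˡ-< (suc n) y<x) xⁿ≤yⁿ

τ≤root : ∀ t .{{_ : NonZero t}} n .{{_ : NonZero n}} {D Q} →
         divisorConstant t * n ≤ Q → Q < suc D ^ t → τ n ≤ D
τ≤root t n Cn≤Q Q<[1+D]ᵗ = ≮⇒≥ λ D<τ → <⇒≱ Q<[1+D]ᵗ (≤-trans (^-monoˡ-≤ t D<τ) (≤-trans (τ-bound t n) Cn≤Q))

-- The exponent ε = 1 / K of the theorem corresponds to t = 4 K in the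
-- divisor bound; p₀ is chosen so that the divisor count D of numbers up to
-- 3 p ^ 2 satisfies (256 D ^ 2) ^ K ≤ p ^ 2.
module Exponent (k : ℕ) where

  K = suc k
  t = 4 * K
  C = divisorConstant t

  p₀ : ℕ
  p₀ = 256 ^ (2 * K) * (3 * C)

  -- The key estimate (256 D ^ 2) ^ K ≤ p ^ 2: its square is at most
  -- 256 ^ (2 K) D ^ t ≤ p₀ p ^ 2 ≤ p ^ 4.
  divisor-budget : ∀ p D → p₀ ≤ p → 1 ≤ p → D ^ t ≤ C * (3 * p * p) → (256 * (D * D)) ^ K ≤ p * p
  divisor-budget p D p₀≤p 1≤p Dᵗ≤Q = pow-cancel 1 ((256 * (D * D)) ^ K) (p * p) (begin
    ((256 * (D * D)) ^ K) ^ 2       ≡⟨ ^-*-assoc (256 * (D * D)) K 2 ⟩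
    (256 * (D * D)) ^ (K * 2)       ≡⟨ cong ((256 * (D * D)) ^_) (*-comm K 2) ⟩
    (256 * (D * D)) ^ (2 * K)       ≡⟨ *-^ 256 (D * D) (2 * K) ⟩
    256 ^ (2 * K) * (D * D) ^ K′    ≡⟨ cong (256 ^ (2 * K) *_) D²ᴷ′≡Dᵗ ⟩
    256 ^ (2 * K) * D ^ t           ≤⟨ *-monoʳ-≤ (256 ^ (2 * K)) Dᵗ≤Q ⟩
    256 ^ (2 * K) * (C * (3 * p * p)) ≡⟨ regroup (256 ^ (2 * K)) C p ⟩
    p₀ * (p * p)                    ≤⟨ *-monoˡ-≤ (p * p) (≤-trans p₀≤p (m≤m*n p p {{>-nonZero 1≤p}})) ⟩
    (p * p) * (p * p)               ≡⟨ cong ((p * p) *_) (*-identityʳ (p * p)) ⟨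
    (p * p) ^ 2                     ∎)
    where
    open ≤-Reasoning
    K′ = 2 * K
    D²ᴷ′≡Dᵗ : (D * D) ^ K′ ≡ D ^ t
    D²ᴷ′≡Dᵗ = trans (sym (^-double D K′)) (cong (D ^_) (sym (*-assoc 2 2 K)))
    regroup : ∀ a C p → a * (C * (3 * p * p)) ≡ a * (3 * C) * (p * p)
    regroup = solve-∀

  short-range : ∀ p N D → p₀ ≤ p → 1 ≤ p → D ^ t ≤ C * (3 * p * p) → N ≤ 2 * D → N ^ K ≤ p
  short-range p N D p₀≤p 1≤p Dᵗ≤Q N≤2D = pow-cancel 1 (N ^ K) p (begin
    (N ^ K) ^ 2             ≡⟨ ^-*-assoc N K 2 ⟩
    N ^ (K * 2)             ≡⟨ cong (N ^_) (*-comm K 2) ⟩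
    N ^ (2 * K)             ≡⟨ ^-double N K ⟩
    (N * N) ^ K             ≤⟨ ^-monoˡ-≤ K N²≤256D² ⟩
    (256 * (D * D)) ^ K     ≤⟨ divisor-budget p D p₀≤p 1≤p Dᵗ≤Q ⟩
    p * p                   ≡⟨ cong (p *_) (*-identityʳ p) ⟨
    p ^ 2                   ∎)
    where
    open ≤-Reasoning
    N²≤256D² : N * N ≤ 256 * (D * D)
    N²≤256D² = begin
      N * N                   ≤⟨ *-mono-≤ N≤2D N≤2D ⟩
      2 * D * (2 * D)         ≡⟨ regroup D ⟩
      4 * (D * D)             ≤⟨ *-monoˡ-≤ (D * D) {4} {256} (m≤m+n 4 252) ⟩
      256 * (D * D)           ∎
      where
      regroup : ∀ D → 2 * D * (2 * D) ≡ 4 * (D * D)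
      regroup = solve-∀

  -- Many candidate blocks: from N ≤ 4 J D, J T ≤ 2 M and p ≤ 4 T ^ 2 L we
  -- get N ^ 2 p ≤ 256 D ^ 2 M ^ 2 L; its K-th power is the first
  -- alternative of the theorem.
  long-range : ∀ p N D J T L M → p₀ ≤ p → 1 ≤ p → D ^ t ≤ C * (3 * p * p) →
               N ≤ 4 * J * D → J * T ≤ 2 * M → p ≤ 4 * T * T * L →
               N ^ (2 * K) * p ^ K ≤ p ^ 2 * L ^ K * M ^ (2 * K)
  long-range p N D J T L M p₀≤p 1≤p Dᵗ≤Q N≤4JD JT≤2M p≤4T²L = begin
    N ^ (2 * K) * p ^ K                    ≡⟨ cong (_* p ^ K) (^-double N K) ⟩
    (N * N) ^ K * p ^ K                    ≡⟨ *-^ (N * N) p K ⟨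
    (N * N * p) ^ K                        ≤⟨ ^-monoˡ-≤ K N²p≤256D²M²L ⟩
    (256 * (D * D) * (M * M * L)) ^ K      ≡⟨ *-^ (256 * (D * D)) (M * M * L) K ⟩
    (256 * (D * D)) ^ K * (M * M * L) ^ K  ≤⟨ *-monoˡ-≤ ((M * M * L) ^ K) (divisor-budget p D p₀≤p 1≤p Dᵗ≤Q) ⟩
    p * p * (M * M * L) ^ K                ≡⟨ cong (p * p *_) (*-^ (M * M) L K) ⟩
    p * p * ((M * M) ^ K * L ^ K)          ≡⟨ cong (λ x → p * p * (x * L ^ K)) (^-double M K) ⟨
    p * p * (M ^ (2 * K) * L ^ K)          ≡⟨ regroup (p * p) (M ^ (2 * K)) (L ^ K) ⟩
    p * p * L ^ K * M ^ (2 * K)            ≡⟨ cong (λ x → p * x * L ^ K * M ^ (2 * K)) (*-identityʳ p) ⟨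
    p ^ 2 * L ^ K * M ^ (2 * K)            ∎
    where
    open ≤-Reasoning
    regroup : ∀ a b c → a * (b * c) ≡ a * c * b
    regroup = solve-∀
    N²p≤256D²M²L : N * N * p ≤ 256 * (D * D) * (M * M * L)
    N²p≤256D²M²L = begin
      N * N * p                                   ≤⟨ *-mono-≤ (*-mono-≤ N≤4JD N≤4JD) p≤4T²L ⟩
      (4 * J * D) * (4 * J * D) * (4 * T * T * L) ≡⟨ regroup₁ J D T L ⟩
      64 * ((J * T) * (J * T)) * L * (D * D)      ≤⟨ *-monoˡ-≤ (D * D) (*-monoˡ-≤ L (*-monoʳ-≤ 64 (*-mono-≤ JT≤2M JT≤2M))) ⟩
      64 * ((2 * M) * (2 * M)) * L * (D * D)      ≡⟨ regroup₂ M L D ⟩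
      256 * (D * D) * (M * M * L)                 ∎
      where
      regroup₁ : ∀ J D T L → (4 * J * D) * (4 * J * D) * (4 * T * T * L) ≡ 64 * ((J * T) * (J * T)) * L * (D * D)
      regroup₁ = solve-∀
      regroup₂ : ∀ M L D → 64 * ((2 * M) * (2 * M)) * L * (D * D) ≡ 256 * (D * D) * (M * M * L)
      regroup₂ = solve-∀

  -- Either ⌊2 M / T⌋ = 0, so N ≤ 2 D, or N ≤ 2 (J + 1) D ≤ 4 J D with J ≥ 1.
  conclude : ∀ p N D T L M .{{_ : NonZero T}} → p₀ ≤ p → 1 ≤ p → D ^ t ≤ C * (3 * p * p) →
             p ≤ 4 * T * T * L → N ≤ suc (2 * M / T) * (D + D) →
             N ^ (2 * K) * p ^ K ≤ p ^ 2 * L ^ K * M ^ (2 * K) ⊎ N ^ K ≤ p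
  conclude p N D T L M p₀≤p 1≤p Dᵗ≤Q p≤4T²L N≤[J+1][2D] with 2 * M / T | m/n*n≤m (2 * M) T
  ... | zero  | _     = inj₂ (short-range p N D p₀≤p 1≤p Dᵗ≤Q (≤-trans N≤[J+1][2D] (≤-reflexive (double D))))
    where
    double : ∀ D → 1 * (D + D) ≡ 2 * D
    double = solve-∀
  ... | suc J | JT≤2M = inj₁ (long-range p N D (suc J) T L M p₀≤p 1≤p Dᵗ≤Q
                               (≤-trans N≤[J+1][2D] ([J+2][2D]≤4[J+1]D J D)) JT≤2M p≤4T²L)
    where
    [J+2][2D]≤4[J+1]D : ∀ J D → suc (suc J) * (D + D) ≤ 4 * suc J * D
    [J+2][2D]≤4[J+1]D J D = ≤-trans (m≤m+n _ (2 * J * D)) (≤-reflexive (expand J D))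
      where
      expand : ∀ J D → suc (suc J) * (D + D) + 2 * J * D ≡ 4 * suc J * D
      expand = solve-∀

lemma6 : (k : ℕ) → ∃ λ p₀ → (p : ℕ) → .{{_ : NonZero p}} → p₀ ≤ p → Prime p →
           (B L M : ℕ) → B < B + L → B + L < p → M < p →
           (solCount p B L M ^ (2 * suc k)) * p ^ suc k ≤ p ^ 2 * L ^ suc k * M ^ (2 * suc k)
           ⊎ solCount p B L M ^ suc k ≤ p
lemma6 k = p₀ , λ p p₀≤p p-prime B L M B<B+L B+L<p M<p →
  let 1≤L = +-cancelˡ-< B 0 L (subst (_< B + L) (sym (+-identityʳ B)) B<B+L)
      L<p = ≤-<-trans (m≤n+m L B) B+L<p
      1≤p = ≤-trans 1≤L (<⇒≤ L<p)
      T , 1≤T , T²L≤p , p≤4T²L = choose-T p L 1≤L (<⇒≤ L<p)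
      D , Dᵗ≤Q , Q<[1+D]ᵗ = choose-root t (C * (3 * p * p))
      τ≤D = λ n 1≤n n≤3p² → τ≤root t n {{>-nonZero 1≤n}} (*-monoʳ-≤ C n≤3p²) Q<[1+D]ᵗ
      instance T≢0 = >-nonZero 1≤T
  in conclude p (solCount p B L M) D T L M p₀≤p 1≤p Dᵗ≤Q p≤4T²L
       (solCount-bound p p-prime B L M 1≤L B+L<p M<p T T²L≤p D τ≤D)
  where open Exponent k
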